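{- Let $\mathfrak{t}$ be a tree-like Hoffman graph in which every internal (non-leaf) vertex has valency at most $3$ and every fat vertex is a leaf, and let $m=|V_s(\mathfrak{t})|$. Then $\mathfrak{t}$ is an induced Hoffman subgraph of a tree-like Hoffman graph $\tilde{\mathfrak{t}}=h_s(\mathfrak{t}_1,\ldots,\mathfrak{t}_m)$ with $|V_s(\tilde{\mathfrak{t}})|=m$, where each $\mathfrak{t}_i$ is isomorphic to the Hoffman graph consisting of one slim vertex and three fat neighbours. In particular, $\mathfrak{t}$ is integrally representable of norm $3$.
   Context: A Hoffman graph $\mathfrak{h}$ is a finite simple graph $H$ whose vertices are labelled slim or fat, such that every fat vertex is adjacent to at least one slim vertex and fat vertices are pairwise nonadjacent; $V_s(\mathfrak{h})$, $V_f(\mathfrak{h})$ are the slim/fat vertex sets. An induced Hoffman subgraph is an induced subgraph of $H$ with inherited labels; isomorphisms are label-preserving. $\mathfrak{h}$ is tree-like if $H$ is a tree. $\mathfrak{h}$ is integrally representable of norm $3$ if there is $\phi:V(\mathfrak{h})\to\mathbb{Z}^n$ with $(\phi(x),\phi(x))=3$ for slim $x$, $=1$ for fat $x$, and for distinct $x,y$: $(\phi(x),\phi(y))=1$ if adjacent, $0$ otherwise. Direct sum and stripped Hoffman graph: let $\mathfrak{h}_1,\ldots,\mathfrak{h}_r$ be Hoffman graphs with pairwise disjoint slim vertex sets (fat vertices may be shared), such that a slim vertex of $\mathfrak{h}_i$ and one of $\mathfrak{h}_j$ ($i\ne j$) have at most one common fat neighbour. $\oplus_i\mathfrak{h}_i$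 is the Hoffman graph on $\bigcup_iV(\mathfrak{h}_i)$ with the adjacencies of each $\mathfrak{h}_i$, and slim $x\in V_s(\mathfrak{h}_i)$, $y\in V_s(\mathfrak{h}_j)$ ($i\ne j$) adjacent iff they have a common fat neighbour. $h_s(\mathfrak{h}_1,\ldots,\mathfrak{h}_r)$ is obtained from $\oplus_i\mathfrak{h}_i$ by deleting all fat vertices in $V_f(\mathfrak{h}_i)\cap V_f(\mathfrak{h}_j)$ for some $i<j$. -}

module Defs where

open import Data.Bool using (Bool; true; false; _∧_; _∨_; not; T; if_then_else_)
open import Data.Nat using (ℕ; zero; suc; _≤_; _≡ᵇ_; _≤ᵇ_)
open import Data.Fin using (Fin; toℕ)
open import Data.Bool.ListAction using (any)
open import Data.List using (List; []; _∷_; _++_; length; filterᵇ; concatMap; deduplicateᵇ; allFin; map; last)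
open import Data.List.Membership.Propositional using (_∈_)
open import Data.List.Relation.Unary.All using (All)
open import Data.List.Relation.Unary.Unique.Propositional using (Unique)
open import Data.List.Relation.Unary.Linked using (Linked)
open import Data.Maybe using (just)
open import Data.Integer using (ℤ; +_)
import Data.Integer as ℤ
open import Data.Vec using (Vec; foldr; zipWith)
open import Data.Product using (Σ; _×_; ∃; ∃-syntax; _,_)
open import Relation.Binary.PropositionalEquality using (_≡_; _≢_)
open import Relation.Nullary using (¬_)

-- Vertices are named by natural numbers (a common
-- universe of names is needed so that different Hoffman graphs can
-- share fat vertices, as in the direct sum).  A Hoffman graph is given
-- by its list of slim vertices, its list of fat vertices, and a
-- (Boolean) adjacency function; only its values on vertices matter.

record HGraph : Set where
  field
    slim : List ℕ
    fat  : List ℕ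
    adj  : ℕ → ℕ → Bool
open HGraph public

verts : HGraph → List ℕ
verts h = slim h ++ fat h

_∈ᵇ_ : ℕ → List ℕ → Bool
x ∈ᵇ xs = any (λ y → y ≡ᵇ x) xs

Adj : HGraph → ℕ → ℕ → Set
Adj h x y = T (adj h x y)

record IsHoffman (h : HGraph) : Set where
  field
    uniqueV   : Unique (verts h)
    irrefl    : ∀ x → x ∈ verts h → ¬ Adj h x x
    sym       : ∀ x y → x ∈ verts h → y ∈ verts h → Adj h x y → Adj h y x
    fatIndep  : ∀ f g → f ∈ fat h → g ∈ fat h → ¬ Adj h f g
    fatHasNbr : ∀ f → f ∈ fat h → ∃[ x ] (x ∈ slim h × Adj h f x)

data Walk (h : HGraph) : ℕ → ℕ → Set where
  here : ∀ {x} → x ∈ verts h → Walk h x x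
  step : ∀ {x y z} → x ∈ verts h → Adj h x y → Walk h y z → Walk h x z

Connected : HGraph → Set
Connected h = ∀ x y → x ∈ verts h → y ∈ verts h → Walk h x y

IsCycle : HGraph → List ℕ → Set
IsCycle h [] = ⊥′ where open import Data.Empty renaming (⊥ to ⊥′)
IsCycle h (v ∷ vs) =
  All (_∈ verts h) (v ∷ vs) × Unique (v ∷ vs) × 3 ≤ length (v ∷ vs)
  × Linked (Adj h) (v ∷ vs) × Σ ℕ (λ w → last (v ∷ vs) ≡ just w × Adj h w v)

Acyclic : HGraph → Set
Acyclic h = ∀ c → ¬ IsCycle h c

TreeLike : HGraph → Set
TreeLike h = (1 ≤ length (verts h)) × Connected h × Acyclic h

degree : HGraph → ℕ → ℕ
degree h v = length (filterᵇ (adj h v) (verts h))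

IsLeaf : HGraph → ℕ → Set
IsLeaf h v = degree h v ≡ 1

record Embedding (h g : HGraph) (φ : ℕ → ℕ) : Set where
  field
    injective : ∀ x y → x ∈ verts h → y ∈ verts h → φ x ≡ φ y → x ≡ y
    slim↦slim : ∀ x → x ∈ slim h → φ x ∈ slim g
    fat↦fat   : ∀ x → x ∈ fat h → φ x ∈ fat g
    adjPres   : ∀ x y → x ∈ verts h → y ∈ verts h → adj h x y ≡ adj g (φ x) (φ y)

InducedSub : HGraph → HGraph → Set
InducedSub h g = ∃[ φ ] Embedding h g φ

Isomorphic : HGraph → HGraph → Set
Isomorphic h g = ∃[ φ ] (Embedding h g φ × (∀ y → y ∈ verts g → ∃[ x ] (x ∈ verts h × φ x ≡ y)))

claw : HGraph
claw = record
  { slim = 0 ∷ []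
  ; fat  = 1 ∷ 2 ∷ 3 ∷ []
  ; adj  = λ x y → ((x ≡ᵇ 0) ∧ (y ∈ᵇ (1 ∷ 2 ∷ 3 ∷ [])))
                 ∨ ((y ≡ᵇ 0) ∧ (x ∈ᵇ (1 ∷ 2 ∷ 3 ∷ [])))
  }

module _ {r : ℕ} (hs : Fin r → HGraph) where

  private
    idx = allFin r

  fatMult : ℕ → ℕ
  fatMult f = length (filterᵇ (λ i → f ∈ᵇ fat (hs i)) idx)

  commonFat : Fin r → Fin r → ℕ → ℕ → Bool
  commonFat i j x y =
    any (λ f → (f ∈ᵇ fat (hs j)) ∧ adj (hs i) x f ∧ adj (hs j) y f) (fat (hs i))

  sumAdj : ℕ → ℕ → Bool
  sumAdj x y =
    any (λ i → (x ∈ᵇ verts (hs i)) ∧ (y ∈ᵇ verts (hs i)) ∧ adj (hs i) x y) idx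
    ∨ any (λ i → any (λ j → not (toℕ i ≡ᵇ toℕ j)
                          ∧ (x ∈ᵇ slim (hs i)) ∧ (y ∈ᵇ slim (hs j))
                          ∧ commonFat i j x y) idx) idx

  record DirectSumOK : Set where
    field
      slimDisjoint : ∀ i j x → i ≢ j → x ∈ slim (hs i) → ¬ (x ∈ slim (hs j))
      labelsConsistent : ∀ i j x → x ∈ slim (hs i) → ¬ (x ∈ fat (hs j))
      atMostOneCommonFat : ∀ i j x y f g → i ≢ j → x ∈ slim (hs i) → y ∈ slim (hs j)
        → f ∈ fat (hs i) → f ∈ fat (hs j) → Adj (hs i) x f → Adj (hs j) y f
        → g ∈ fat (hs i) → g ∈ fat (hs j) → Adj (hs i) x g → Adj (hs j) y g
        → f ≡ g

  directSum : HGraph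
  directSum = record
    { slim = concatMap (λ i → slim (hs i)) idx
    ; fat  = deduplicateᵇ _≡ᵇ_ (concatMap (λ i → fat (hs i)) idx)
    ; adj  = sumAdj
    }

  -- h_s: delete fat vertices lying in two different members
  stripped : HGraph
  stripped = record
    { slim = slim directSum
    ; fat  = filterᵇ (λ f → fatMult f ≤ᵇ 1) (fat directSum)
    ; adj  = sumAdj
    }

dot : ∀ {n} → Vec ℤ n → Vec ℤ n → ℤ
dot u v = foldr _ ℤ._+_ (+ 0) (zipWith ℤ._*_ u v)

IntRepNorm3 : HGraph → Set
IntRepNorm3 h = ∃[ n ] Σ (ℕ → Vec ℤ n) λ φ →
    (∀ x → x ∈ slim h → dot (φ x) (φ x) ≡ + 3)
  × (∀ x → x ∈ fat h → dot (φ x) (φ x) ≡ + 1)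
  × (∀ x y → x ∈ verts h → y ∈ verts h → x ≢ y →
       (Adj h x y → dot (φ x) (φ y) ≡ + 1) × (¬ Adj h x y → dot (φ x) (φ y) ≡ + 0))

-- Give every slim vertex s of t a claw whose three fat vertices are the fat neighbours of s (leaves,
-- so they lie in no other claw), one new fat vertex shared with the claw of each slim neighbour of
-- s, and new private pads; three suffice since s has degree at most 3. Any two claws share at most
-- one fat vertex, and exactly when their centres are adjacent in t, so the stripped sum contains t
-- as an induced subgraph, with the shared fat vertices deleted and the pads added as leaves. The
-- remaining fat vertices have a single neighbour, so a cycle of the sum lies on slim vertices and
-- is a cycle of t. Representing a slim vertex by the sum of the unit vectors of its claw's fat
-- vertices and a fat vertex by its own unit vector gives norms 3 and 1, and inner product 1 exactly
-- on edges.

module Submission where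

open import Defs
open import Data.Bool using (Bool; true; false; _∧_; _∨_; not; T; if_then_else_)
open import Data.Bool.Properties using (T?; T-∧; T-∨; T-≡; T-not-≡)
open import Data.Bool.ListAction using (any)
open import Data.Empty using (⊥; ⊥-elim)
open import Data.Fin using (Fin; toℕ) renaming (zero to fzero; suc to fsuc)
import Data.Fin as Fin
open import Data.Fin.Properties using (toℕ-injective)
open import Data.Integer using (ℤ; +_)
import Data.Integer as ℤ
open import Data.List using (List; []; _∷_; _++_; length; filter; filterᵇ; concatMap; deduplicate; deduplicateᵇ; allFin; map; last; lookup; upTo; applyUpTo; tabulate; [_])
open import Data.List.Properties using (++-assoc; ++-identityʳ; length-++; length-++-comm; length-map; filter-≐; ∷-injectiveˡ; ∷-injectiveʳ; map-cong-local; map-∘; map-upTo; length-upTo; concatMap-map; concatMap-pure; map-tabulate; tabulate-lookup)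
open import Data.List.Membership.Propositional using (_∈_; _∉_; find; lose)
open import Data.List.Membership.Propositional.Properties using (∈-++⁺ˡ; ∈-++⁺ʳ; ∈-++⁻; ∈-map⁺; ∈-map⁻; ∈-filter⁺; ∈-filter⁻; ∈-∃++; ∈-lookup; ∈-allFin; ∈-deduplicate⁺; ∈-deduplicate⁻; ∈-concatMap⁺; ∈-concatMap⁻)
open import Data.List.Relation.Unary.Any as Any using (here; there; satisfied)
open import Data.List.Relation.Unary.Any.Properties using (any⁺; any⁻; lookup-index)
open import Data.List.Relation.Unary.All as All using (All; []; _∷_)
import Data.List.Relation.Unary.All.Properties as All
open import Data.List.Relation.Unary.AllPairs using ([]; _∷_)
open import Data.List.Relation.Unary.Unique.Propositional using (Unique)
open import Data.List.Relation.Unary.Linked using (Linked; []; [-]; _∷_)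
import Data.List.Relation.Unary.Linked.Properties as Linked
import Data.Maybe.Relation.Binary.Connected as Maybe
open import Data.Maybe using (just)
open import Data.Nat using (ℕ; zero; suc; _+_; _*_; _∸_; _≤_; _<_; z≤n; s≤s; _≡ᵇ_; _≤ᵇ_; _⊔_; _⊓_; _≟_; >-nonZero)
open import Data.Nat.Properties
open import Data.List.Relation.Unary.Unique.DecPropositional.Properties _≟_ using (deduplicate-!; filter⁺; map⁺; ++⁺; allFin⁺; upTo⁺)
open import Data.List.Membership.DecPropositional _≟_ using (_∈?_)
open import Data.Nat.DivMod using (_%_; m<n⇒m%n≡m; [m+kn]%n≡m%n)
open import Data.Nat.ListAction using (sum)
open import Data.Product using (Σ; _×_; ∃-syntax; _,_; proj₁; proj₂)
open import Data.Sum using (_⊎_; inj₁; inj₂; [_,_]′; swap)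
open import Data.Unit using (tt)
open import Data.Vec using (Vec) renaming (tabulate to tabulateᵛ)
open import Function using (_∘_; id; case_of_; _⇔_; Equivalence; mk⇔)
open import Relation.Binary.PropositionalEquality using (_≡_; _≢_; refl; sym; trans; cong; cong₂; subst; subst₂; module ≡-Reasoning)
open import Relation.Nullary using (¬_; Dec; yes; no; does)
open import Relation.Nullary.Decidable using (dec-true; dec-false)

open Equivalence using (to; from)

private
  variable
    A : Set
    x y : A
    xs ys : List A

T⇔T⇒≡ : ∀ {a b} → (T a → T b) → (T b → T a) → a ≡ b
T⇔T⇒≡ {false} {false} _ _ = refl
T⇔T⇒≡ {false} {true}  _ g = ⊥-elim (g tt)
T⇔T⇒≡ {true}  {false} f _ = ⊥-elim (f tt)
T⇔T⇒≡ {true}  {true}  _ _ = refl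

∈ᵇ⇒∈ : ∀ {n ns} → T (n ∈ᵇ ns) → n ∈ ns
∈ᵇ⇒∈ {n} {ns} p = Any.map (λ {m} q → sym (≡ᵇ⇒≡ m n q)) (any⁻ _ ns p)

∈⇒∈ᵇ : ∀ {n ns} → n ∈ ns → T (n ∈ᵇ ns)
∈⇒∈ᵇ {n} p = any⁺ _ (Any.map (λ {m} e → ≡⇒≡ᵇ m n (sym e)) p)

if-yes : ∀ {P : Set} (p? : Dec P) {a b : A} → P → (if does p? then a else b) ≡ a
if-yes p? p = cong (if_then _ else _) (dec-true p? p)

if-no : ∀ {P : Set} (p? : Dec P) {a b : A} → ¬ P → (if does p? then a else b) ≡ b
if-no p? ¬p = cong (if_then _ else _) (dec-false p? ¬p)

∈-filterᵇ⁻ : ∀ (p : A → Bool) → x ∈ filterᵇ p xs → x ∈ xs × T (p x)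
∈-filterᵇ⁻ p = ∈-filter⁻ (T? ∘ p)

∈-filterᵇ⁺ : ∀ (p : A → Bool) → x ∈ xs → T (p x) → x ∈ filterᵇ p xs
∈-filterᵇ⁺ p = ∈-filter⁺ (T? ∘ p)

∈⇒≤sum : ∀ {n ns} → n ∈ ns → n ≤ sum ns
∈⇒≤sum {ns = m ∷ ms} (here refl) = m≤m+n m (sum ms)
∈⇒≤sum {ns = m ∷ ms} (there p)   = ≤-trans (∈⇒≤sum p) (m≤n+m (sum ms) m)

∈⇒1≤length : x ∈ xs → 1 ≤ length xs
∈⇒1≤length (here _)  = s≤s z≤n
∈⇒1≤length (there _) = s≤s z≤n

1≤length⇒∃∈ : 1 ≤ length xs → ∃[ x ] x ∈ xs
1≤length⇒∃∈ {xs = x ∷ _} _ = x , here refl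

distinct⇒2≤length : x ≢ y → x ∈ xs → y ∈ xs → 2 ≤ length xs
distinct⇒2≤length x≢y (here refl) (here refl) = ⊥-elim (x≢y refl)
distinct⇒2≤length x≢y (here _)    (there q)   = s≤s (∈⇒1≤length q)
distinct⇒2≤length x≢y (there p)   (here _)    = s≤s (∈⇒1≤length p)
distinct⇒2≤length x≢y (there p)   (there q)   = m≤n⇒m≤1+n (distinct⇒2≤length x≢y p q)

length≤1 : Unique xs → (∀ {a b} → a ∈ xs → b ∈ xs → a ≡ b) → length xs ≤ 1
length≤1 {xs = []}         _             _  = z≤n
length≤1 {xs = _ ∷ []}     _             _  = s≤s z≤n
length≤1 {xs = _ ∷ _ ∷ _} ((a≢b ∷ _) ∷ _) eq = ⊥-elim (a≢b (eq (here refl) (there (here refl))))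

unique-map⁺ : ∀ {B : Set} (f : A → B) → (∀ {x y} → x ∈ xs → y ∈ xs → f x ≡ f y → x ≡ y) →
              Unique xs → Unique (map f xs)
unique-map⁺ f f-inj []          = []
unique-map⁺ f f-inj (x∉ ∷ uniq) =
  All.map⁺ (All.tabulate (λ y∈ fx≡fy → All.lookup x∉ y∈ (f-inj (here refl) (there y∈) fx≡fy))) ∷
  unique-map⁺ f (λ x∈ y∈ → f-inj (there x∈) (there y∈)) uniq

unique-++⁻ˡ : Unique (xs ++ ys) → Unique xs
unique-++⁻ˡ {xs = []}     _          = []
unique-++⁻ˡ {xs = x ∷ xs} (x∉ ∷ uniq) = All.++⁻ˡ xs x∉ ∷ unique-++⁻ˡ uniq

unique-++-disjoint : Unique (xs ++ ys) → x ∈ xs → x ∈ ys → ⊥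
unique-++-disjoint {xs = _ ∷ xs} (x∉ ∷ _)    (here refl) q = All.lookup x∉ (∈-++⁺ʳ xs q) refl
unique-++-disjoint {xs = _ ∷ _}  (_ ∷ uniq)  (there p)   q = unique-++-disjoint uniq p q

digits-injective : ∀ {d r r′ q q′} → r < d → r′ < d → r + q * d ≡ r′ + q′ * d → r ≡ r′ × q ≡ q′
digits-injective {d} {r} {r′} {q} {q′} r<d r′<d eq = r≡r′ , *-cancelʳ-≡ q q′ d q*d≡q′*d
  where
  instance _ = >-nonZero (≤-<-trans z≤n r<d)
  open ≡-Reasoning
  r≡r′ : r ≡ r′
  r≡r′ = begin
    r                  ≡⟨ sym (m<n⇒m%n≡m r<d) ⟩
    r % d              ≡⟨ sym ([m+kn]%n≡m%n r q d) ⟩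
    (r + q * d) % d    ≡⟨ cong (_% d) eq ⟩
    (r′ + q′ * d) % d  ≡⟨ [m+kn]%n≡m%n r′ q′ d ⟩
    r′ % d             ≡⟨ m<n⇒m%n≡m r′<d ⟩
    r′                 ∎
  q*d≡q′*d : q * d ≡ q′ * d
  q*d≡q′*d = +-cancelˡ-≡ r _ _ (trans eq (cong (_+ q′ * d) (sym r≡r′)))

⊓-⊔-sorted : ∀ a b → (a ⊓ b ≡ a × a ⊔ b ≡ b) ⊎ (a ⊓ b ≡ b × a ⊔ b ≡ a)
⊓-⊔-sorted a b with ≤-total a b
... | inj₁ a≤b = inj₁ (m≤n⇒m⊓n≡m a≤b , m≤n⇒m⊔n≡n a≤b)
... | inj₂ b≤a = inj₂ (m≥n⇒m⊓n≡n b≤a , m≥n⇒m⊔n≡m b≤a)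

⊓-⊔-injective : ∀ {a b c d} → a ⊓ b ≡ c ⊓ d → a ⊔ b ≡ c ⊔ d → (a ≡ c × b ≡ d) ⊎ (a ≡ d × b ≡ c)
⊓-⊔-injective {a} {b} {c} {d} ⊓≡ ⊔≡ with ⊓-⊔-sorted a b | ⊓-⊔-sorted c d
... | inj₁ (a₁ , b₁) | inj₁ (c₁ , d₁) = inj₁ (trans (sym a₁) (trans ⊓≡ c₁) , trans (sym b₁) (trans ⊔≡ d₁))
... | inj₁ (a₁ , b₁) | inj₂ (d₁ , c₁) = inj₂ (trans (sym a₁) (trans ⊓≡ d₁) , trans (sym b₁) (trans ⊔≡ c₁))
... | inj₂ (b₁ , a₁) | inj₁ (c₁ , d₁) = inj₂ (trans (sym a₁) (trans ⊔≡ d₁) , trans (sym b₁) (trans ⊓≡ c₁))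
... | inj₂ (b₁ , a₁) | inj₂ (d₁ , c₁) = inj₁ (trans (sym a₁) (trans ⊔≡ c₁) , trans (sym b₁) (trans ⊓≡ d₁))


-- Walks and cycles

walk-source : ∀ {h a b} → Walk h a b → a ∈ verts h
walk-source (here a∈)     = a∈
walk-source (step a∈ _ _) = a∈

walk-++ : ∀ {h a b c} → Walk h a b → Walk h b c → Walk h a c
walk-++ (here _)     w = w
walk-++ (step a e v) w = step a e (walk-++ v w)

last-∷ʳ : ∀ (xs : List A) z → last (xs ++ z ∷ []) ≡ just z
last-∷ʳ []           z = refl
last-∷ʳ (_ ∷ [])     z = refl
last-∷ʳ (_ ∷ y ∷ xs) z = last-∷ʳ (y ∷ xs) z

last-∈ : ∀ (xs : List A) {z} → last xs ≡ just z → z ∈ xs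
last-∈ (_ ∷ [])     refl = here refl
last-∈ (_ ∷ y ∷ xs) eq   = there (last-∈ (y ∷ xs) eq)

cycle-vertices : ∀ {h} c → IsCycle h c → All (_∈ verts h) c
cycle-vertices (_ ∷ _) cyc = proj₁ cyc

module _ {h : HGraph} where

  rotate-head : ∀ {u} l → IsCycle h (u ∷ l) → IsCycle h (l ++ u ∷ [])
  rotate-head {u} (a ∷ rest) (u∈ ∷ ∈s , u∉ ∷ uniq , 3≤ , uRa ∷ linked , w , last≡w , wRu) =
    All.∷ʳ⁺ ∈s u∈ ,
    ++⁺ uniq ([] ∷ []) (λ { (p , here refl) → All.lookup u∉ p refl }) ,
    subst (3 ≤_) (length-++-comm (u ∷ []) (a ∷ rest)) 3≤ ,
    Linked.++⁺ linked (subst (λ m → Maybe.Connected (Adj h) m (just u)) (sym last≡w) (Maybe.just wRu)) [-] ,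
    u , last-∷ʳ (a ∷ rest) u , uRa
  rotate-head [] (_ , _ , s≤s () , _)

  rotate : ∀ ys {v zs} → IsCycle h (ys ++ v ∷ zs) → IsCycle h (v ∷ zs ++ ys)
  rotate []       {v} {zs} c = subst (λ l → IsCycle h (v ∷ l)) (sym (++-identityʳ zs)) c
  rotate (y ∷ ys) {v} {zs} c =
    subst (λ l → IsCycle h (v ∷ l)) (++-assoc zs (y ∷ []) ys)
      (rotate ys (subst (IsCycle h) (++-assoc ys (v ∷ zs) (y ∷ [])) (rotate-head (ys ++ v ∷ zs) c)))

  head-neighbours : ∀ {v} l → IsCycle h (v ∷ l) → ∃[ a ] ∃[ b ] (a ≢ b × Adj h v a × Adj h b v)
  head-neighbours (a ∷ b ∷ rest) (_ , _ ∷ (a∉ ∷ _) , _ , vRa ∷ _ , w , last≡w , wRv) =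
    a , w , (λ { refl → All.lookup a∉ (last-∈ (b ∷ rest) last≡w) refl }) , vRa , wRv
  head-neighbours (_ ∷ []) (_ , _ , s≤s (s≤s ()) , _)
  head-neighbours []       (_ , _ , s≤s () , _)

  cycle-neighbours : ∀ {c v} → IsCycle h c → v ∈ c → ∃[ a ] ∃[ b ] (a ≢ b × Adj h v a × Adj h b v)
  cycle-neighbours c v∈ with ∈-∃++ v∈
  ... | ys , zs , refl = head-neighbours (zs ++ ys) (rotate ys c)

IsCycle-transfer : ∀ {g h} → (∀ {a b} → a ∈ verts g → b ∈ verts g → Adj h a b → Adj g a b) →
                   ∀ c → All (_∈ verts g) c → IsCycle h c → IsCycle g c
IsCycle-transfer {g} {h} adj⇒ (v ∷ vs) ∈g (_ , uniq , 3≤ , linked , w , last≡w , wRv) =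
  ∈g , uniq , 3≤ , linked-transfer ∈g linked , w , last≡w ,
  adj⇒ (All.lookup ∈g (last-∈ (v ∷ vs) last≡w)) (All.lookup ∈g (here refl)) wRv
  where
  linked-transfer : ∀ {l} → All (_∈ verts g) l → Linked (Adj h) l → Linked (Adj g) l
  linked-transfer _               []         = []
  linked-transfer _               [-]        = [-]
  linked-transfer (p ∷ q ∷ ps) (r ∷ rs) = adj⇒ p q r ∷ linked-transfer (q ∷ ps) rs

-- Indicator vectors

count : ℕ → (ℕ → Bool) → ℕ
count zero    p = 0
count (suc n) p = (if p 0 then 1 else 0) + count n (p ∘ suc)

count-cong : ∀ n {p q : ℕ → Bool} → (∀ k → p k ≡ q k) → count n p ≡ count n q
count-cong zero    p≗q = refl
count-cong (suc n) p≗q = cong₂ _+_ (cong (if_then 1 else 0) (p≗q 0)) (count-cong n (p≗q ∘ suc))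

count-false : ∀ n → count n (λ _ → false) ≡ 0
count-false zero    = refl
count-false (suc n) = count-false n

count-∨ : ∀ n {p q : ℕ → Bool} → (∀ k → T (p k) → T (q k) → ⊥) →
          count n (λ k → p k ∨ q k) ≡ count n p + count n q
count-∨ zero    _ = refl
count-∨ (suc n) {p} {q} disjoint with p 0 in p0 | q 0 in q0 | count-∨ n {p ∘ suc} {q ∘ suc} (disjoint ∘ suc)
... | true  | true  | _  = ⊥-elim (disjoint 0 (subst T (sym p0) tt) (subst T (sym q0) tt))
... | true  | false | ih = cong suc ih
... | false | true  | ih = trans (cong suc ih) (sym (+-suc _ _))
... | false | false | ih = ih

count-≡ᵇ : ∀ {n a} → a < n → count n (a ≡ᵇ_) ≡ 1
count-≡ᵇ {suc n} {zero}  _         = cong suc (count-false n)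
count-≡ᵇ {suc n} {suc a} (s≤s a<n) = count-≡ᵇ a<n

count-∈ᵇ : ∀ {n L} → Unique L → All (_< n) L → count n (_∈ᵇ L) ≡ length L
count-∈ᵇ {n} {[]}    _           _           = count-false n
count-∈ᵇ {n} {a ∷ L} (a∉ ∷ uniq) (a<n ∷ L<n) = begin
  count n (λ k → (a ≡ᵇ k) ∨ (k ∈ᵇ L))   ≡⟨ count-∨ n a∉L ⟩
  count n (a ≡ᵇ_) + count n (_∈ᵇ L)     ≡⟨ cong₂ _+_ (count-≡ᵇ a<n) (count-∈ᵇ uniq L<n) ⟩
  suc (length L)                        ∎
  where
  open ≡-Reasoning
  a∉L : ∀ k → T (a ≡ᵇ k) → T (k ∈ᵇ L) → ⊥
  a∉L k a≡k k∈L = All.lookup a∉ (subst (_∈ L) (sym (≡ᵇ⇒≡ a k a≡k)) (∈ᵇ⇒∈ k∈L)) refl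

⟦_⟧ : Bool → ℤ
⟦ b ⟧ = if b then + 1 else + 0

dot-tabulate : ∀ n (p q : ℕ → Bool) →
  dot (tabulateᵛ {n = n} (λ k → ⟦ p (toℕ k) ⟧)) (tabulateᵛ (λ k → ⟦ q (toℕ k) ⟧)) ≡ + count n (λ k → p k ∧ q k)
dot-tabulate zero    p q = refl
dot-tabulate (suc n) p q with p 0 | q 0 | dot-tabulate n (p ∘ suc) (q ∘ suc)
... | true  | true  | ih = cong (ℤ._+_ (+ 1)) ih
... | true  | false | ih = cong (ℤ._+_ (+ 0)) ih
... | false | _     | ih = cong (ℤ._+_ (+ 0)) ih

indicator : (n : ℕ) → List ℕ → Vec ℤ n
indicator n A = tabulateᵛ (λ k → ⟦ toℕ k ∈ᵇ A ⟧)

dot-indicator : ∀ n {A B L} → Unique L → All (_< n) L → (∀ {k} → (k ∈ A × k ∈ B) ⇔ k ∈ L) →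
                dot (indicator n A) (indicator n B) ≡ + length L
dot-indicator n {A} {B} {L} uniq L<n A∩B⇔L =
  trans (dot-tabulate n (_∈ᵇ A) (_∈ᵇ B)) (cong +_ (trans (count-cong n ∩≡L) (count-∈ᵇ uniq L<n)))
  where
  ∩≡L : ∀ k → ((k ∈ᵇ A) ∧ (k ∈ᵇ B)) ≡ (k ∈ᵇ L)
  ∩≡L k = T⇔T⇒≡
    (λ k∈A∩B → let k∈A , k∈B = to T-∧ k∈A∩B in ∈⇒∈ᵇ (to A∩B⇔L (∈ᵇ⇒∈ k∈A , ∈ᵇ⇒∈ k∈B)))
    (λ k∈L → let k∈A , k∈B = from A∩B⇔L (∈ᵇ⇒∈ k∈L) in from T-∧ (∈⇒∈ᵇ k∈A , ∈⇒∈ᵇ k∈B))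

-- Claws

clawAt : ℕ → List ℕ → HGraph
clawAt s L = record
  { slim = s ∷ []
  ; fat  = L
  ; adj  = λ x y → ((x ≡ᵇ s) ∧ (y ∈ᵇ L)) ∨ ((y ≡ᵇ s) ∧ (x ∈ᵇ L))
  }

module _ {s : ℕ} {L : List ℕ} where

  clawAt-adj : ∀ {x y} → Adj (clawAt s L) x y ⇔ ((x ≡ s × y ∈ L) ⊎ (y ≡ s × x ∈ L))
  clawAt-adj {x} {y} = mk⇔ ⇒ ⇐
    where
    ⇒ : Adj (clawAt s L) x y → (x ≡ s × y ∈ L) ⊎ (y ≡ s × x ∈ L)
    ⇒ a with to (T-∨ {(x ≡ᵇ s) ∧ (y ∈ᵇ L)}) a
    ... | inj₁ p = let x≡s , y∈L = to T-∧ p in inj₁ (≡ᵇ⇒≡ x s x≡s , ∈ᵇ⇒∈ y∈L)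
    ... | inj₂ p = let y≡s , x∈L = to T-∧ p in inj₂ (≡ᵇ⇒≡ y s y≡s , ∈ᵇ⇒∈ x∈L)
    ⇐ : (x ≡ s × y ∈ L) ⊎ (y ≡ s × x ∈ L) → Adj (clawAt s L) x y
    ⇐ (inj₁ (x≡s , y∈L)) = from T-∨ (inj₁ (from T-∧ (≡⇒≡ᵇ x s x≡s , ∈⇒∈ᵇ y∈L)))
    ⇐ (inj₂ (y≡s , x∈L)) = from (T-∨ {(x ≡ᵇ s) ∧ (y ∈ᵇ L)}) (inj₂ (from T-∧ (≡⇒≡ᵇ y s y≡s , ∈⇒∈ᵇ x∈L)))

  clawAt-isHoffman : Unique (s ∷ L) → IsHoffman (clawAt s L)
  clawAt-isHoffman uniq@(s∉L ∷ _) = record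
    { uniqueV   = uniq
    ; irrefl    = λ x _ a → [ centre∉L , centre∉L ]′ (to (clawAt-adj {x} {x}) a)
    ; sym       = λ x y _ _ a → from (clawAt-adj {y} {x}) (swap (to (clawAt-adj {x} {y}) a))
    ; fatIndep  = λ f g f∈L g∈L a → [ (λ (f≡s , _) → centre∉L (f≡s , f∈L)) , (λ (g≡s , _) → centre∉L (g≡s , g∈L)) ]′
                                      (to (clawAt-adj {f} {g}) a)
    ; fatHasNbr = λ f f∈L → s , here refl , from clawAt-adj (inj₂ (refl , f∈L))
    }
    where
    centre∉L : ∀ {x} → x ≡ s × x ∈ L → ⊥
    centre∉L (refl , x∈L) = All.lookup s∉L x∈L refl

position : ℕ → List ℕ → ℕ
position x []       = 0
position x (y ∷ ys) = if y ≡ᵇ x then 0 else suc (position x ys)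

position-injective : ∀ {x y} zs → x ∈ zs → y ∈ zs → position x zs ≡ position y zs → x ≡ y
position-injective {x} {y} (z ∷ zs) x∈ y∈ eq with z ≡ᵇ x in zx | z ≡ᵇ y in zy
... | true  | true  = trans (sym (≡ᵇ⇒≡ z x (from T-≡ zx))) (≡ᵇ⇒≡ z y (from T-≡ zy))
... | true  | false = ⊥-elim (0≢1+n eq)
... | false | true  = ⊥-elim (0≢1+n (sym eq))
... | false | false = position-injective zs (∈-tail zx x∈) (∈-tail zy y∈) (suc-injective eq)
  where
  ∈-tail : ∀ {v} → (z ≡ᵇ v) ≡ false → v ∈ z ∷ zs → v ∈ zs
  ∈-tail zv (here refl) = ⊥-elim (subst T zv (≡⇒≡ᵇ z z refl))
  ∈-tail zv (there v∈)  = v∈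

map-position : ∀ zs → Unique zs → map (λ x → position x zs) zs ≡ upTo (length zs)
map-position []       _           = refl
map-position (z ∷ zs) (z∉ ∷ uniq) = cong₂ _∷_ (if-yes (z ≟ z) refl) (begin
  map (λ x → position x (z ∷ zs)) zs      ≡⟨ map-cong-local (All.map (λ {x} → if-no (z ≟ x)) z∉) ⟩
  map (suc ∘ (λ x → position x zs)) zs    ≡⟨ map-∘ zs ⟩
  map suc (map (λ x → position x zs) zs)  ≡⟨ cong (map suc) (map-position zs uniq) ⟩
  map suc (upTo (length zs))              ≡⟨ map-upTo suc (length zs) ⟩
  applyUpTo suc (length zs)               ∎)
  where open ≡-Reasoning

clawAt-relabel : ∀ {s L} (φ : ℕ → ℕ) → (∀ {x y} → x ∈ s ∷ L → y ∈ s ∷ L → φ x ≡ φ y → x ≡ y) →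
                 Isomorphic (clawAt s L) (clawAt (φ s) (map φ L))
clawAt-relabel {s} {L} φ φ-inj = φ , embedding , onto
  where
  ≡ᵇ-pres : ∀ {x} → x ∈ s ∷ L → (x ≡ᵇ s) ≡ (φ x ≡ᵇ φ s)
  ≡ᵇ-pres {x} x∈ = T⇔T⇒≡ (λ p → ≡⇒≡ᵇ _ _ (cong φ (≡ᵇ⇒≡ x s p)))
                         (λ p → ≡⇒≡ᵇ _ _ (φ-inj x∈ (here refl) (≡ᵇ⇒≡ _ _ p)))
  ∈ᵇ-pres : ∀ {y} → y ∈ s ∷ L → (y ∈ᵇ L) ≡ (φ y ∈ᵇ map φ L)
  ∈ᵇ-pres {y} y∈ = T⇔T⇒≡ (λ p → ∈⇒∈ᵇ (∈-map⁺ φ (∈ᵇ⇒∈ {y} {L} p)))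
    (λ p → let z , z∈L , φy≡φz = ∈-map⁻ φ (∈ᵇ⇒∈ p) in ∈⇒∈ᵇ (subst (_∈ L) (sym (φ-inj y∈ (there z∈L) φy≡φz)) z∈L))
  embedding : Embedding (clawAt s L) (clawAt (φ s) (map φ L)) φ
  embedding = record
    { injective = λ _ _ → φ-inj
    ; slim↦slim = λ { _ (here refl) → here refl }
    ; fat↦fat   = λ _ → ∈-map⁺ φ
    ; adjPres   = λ _ _ x∈ y∈ → cong₂ _∨_ (cong₂ _∧_ (≡ᵇ-pres x∈) (∈ᵇ-pres y∈)) (cong₂ _∧_ (≡ᵇ-pres y∈) (∈ᵇ-pres x∈))
    }
  onto : ∀ y → y ∈ verts (clawAt (φ s) (map φ L)) → ∃[ x ] (x ∈ s ∷ L × φ x ≡ y)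
  onto y y∈ = let x , x∈ , y≡φx = ∈-map⁻ φ y∈ in x , x∈ , sym y≡φx

-- Numbering s ∷ L by positions turns clawAt s L into clawAt 0 (1 ∷ 2 ∷ 3 ∷ []), which is claw.
clawAt≅claw : ∀ {s L} → Unique (s ∷ L) → length L ≡ 3 → Isomorphic (clawAt s L) claw
clawAt≅claw {s} {L} uniq |L|≡3 =
  subst₂ (λ c M → Isomorphic (clawAt s L) (clawAt c M)) (∷-injectiveˡ numbering) (∷-injectiveʳ numbering)
    (clawAt-relabel (λ x → position x (s ∷ L)) (position-injective (s ∷ L)))
  where
  numbering : map (λ x → position x (s ∷ L)) (s ∷ L) ≡ upTo 4
  numbering = trans (map-position (s ∷ L) uniq) (cong (upTo ∘ suc) |L|≡3)

-- Stripped sums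

lookup-injective : ∀ {xs : List A} → Unique xs → ∀ {i j} → lookup xs i ≡ lookup xs j → i ≡ j
lookup-injective {xs = _ ∷ _}  _           {fzero}  {fzero}  _  = refl
lookup-injective {xs = _ ∷ xs} (x∉ ∷ _)    {fzero}  {fsuc j} eq = ⊥-elim (All.lookup x∉ (∈-lookup j) eq)
lookup-injective {xs = _ ∷ xs} (x∉ ∷ _)    {fsuc i} {fzero}  eq = ⊥-elim (All.lookup x∉ (∈-lookup i) (sym eq))
lookup-injective {xs = _ ∷ _}  (_ ∷ uniq)  {fsuc i} {fsuc j} eq = cong fsuc (lookup-injective uniq eq)

deduplicateᵇ≡deduplicate : ∀ xs → deduplicateᵇ _≡ᵇ_ xs ≡ deduplicate _≟_ xs
deduplicateᵇ≡deduplicate []       = refl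
deduplicateᵇ≡deduplicate (x ∷ xs) = cong (x ∷_) (trans
  (filter-≐ _ _ ((λ x≢ᵇy x≡y → x≢ᵇy (≡⇒≡ᵇ x _ x≡y)) , (λ x≢y x≡ᵇy → x≢y (≡ᵇ⇒≡ x _ x≡ᵇy))) (deduplicateᵇ _≡ᵇ_ xs))
  (cong (filter _) (deduplicateᵇ≡deduplicate xs)))

data SumAdj {r} (hs : Fin r → HGraph) (x y : ℕ) : Set where
  inside : ∀ i → x ∈ verts (hs i) → y ∈ verts (hs i) → Adj (hs i) x y → SumAdj hs x y
  across : ∀ i j f → i ≢ j → x ∈ slim (hs i) → y ∈ slim (hs j) →
           f ∈ fat (hs i) → f ∈ fat (hs j) → Adj (hs i) x f → Adj (hs j) y f → SumAdj hs x y

module _ {r} (hs : Fin r → HGraph) where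

  stripped-adj : ∀ {x y} → Adj (stripped hs) x y ⇔ SumAdj hs x y
  stripped-adj {x} {y} = mk⇔ ⇒ ⇐
    where
    within : Fin r → Bool
    within i = (x ∈ᵇ verts (hs i)) ∧ (y ∈ᵇ verts (hs i)) ∧ adj (hs i) x y
    sharing : Fin r → Fin r → ℕ → Bool
    sharing i j f = (f ∈ᵇ fat (hs j)) ∧ adj (hs i) x f ∧ adj (hs j) y f
    crossing : Fin r → Fin r → Bool
    crossing i j = not (toℕ i ≡ᵇ toℕ j) ∧ (x ∈ᵇ slim (hs i)) ∧ (y ∈ᵇ slim (hs j)) ∧ any (sharing i j) (fat (hs i))

    ⇒ : Adj (stripped hs) x y → SumAdj hs x y
    ⇒ a with to (T-∨ {any within (allFin r)}) a
    ... | inj₁ p =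
      let i , _ , q = find (any⁻ within (allFin r) p); x∈ , q = to T-∧ q; y∈ , xy = to T-∧ q
      in inside i (∈ᵇ⇒∈ x∈) (∈ᵇ⇒∈ y∈) xy
    ... | inj₂ p =
      let i , _ , q = find (any⁻ (λ i → any (crossing i) (allFin r)) (allFin r) p)
          j , _ , q = find (any⁻ (crossing i) (allFin r) q)
          i≢ᵇj , q = to (T-∧ {not (toℕ i ≡ᵇ toℕ j)}) q; x∈ , q = to T-∧ q; y∈ , q = to T-∧ q
          f , f∈i , q = find (any⁻ (sharing i j) (fat (hs i)) q); f∈j , q = to T-∧ q; xf , yf = to T-∧ q
          i≢j = λ i≡j → subst T (to T-not-≡ i≢ᵇj) (≡⇒≡ᵇ (toℕ i) (toℕ j) (cong toℕ i≡j))
      in across i j f i≢j (∈ᵇ⇒∈ x∈) (∈ᵇ⇒∈ y∈) f∈i (∈ᵇ⇒∈ f∈j) xf yf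

    ⇐ : SumAdj hs x y → Adj (stripped hs) x y
    ⇐ (inside i x∈ y∈ xy) =
      from T-∨ (inj₁ (any⁺ within (lose (∈-allFin i) (from T-∧ (∈⇒∈ᵇ x∈ , from T-∧ (∈⇒∈ᵇ y∈ , xy))))))
    ⇐ (across i j f i≢j x∈ y∈ f∈i f∈j xf yf) =
      from (T-∨ {any within (allFin r)})
        (inj₂ (any⁺ (λ i → any (crossing i) (allFin r))
                (lose (∈-allFin i) (any⁺ (crossing i) (lose (∈-allFin j) linked)))))
      where
      linked : T (crossing i j)
      linked = from T-∧ (from T-not-≡ (dec-false (toℕ i ≟ toℕ j) (i≢j ∘ toℕ-injective)) ,
               from T-∧ (∈⇒∈ᵇ x∈ , from T-∧ (∈⇒∈ᵇ y∈ ,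
               any⁺ (sharing i j) (lose f∈i (from T-∧ (∈⇒∈ᵇ f∈j , from T-∧ (xf , yf)))))))

  private
    allFats : List ℕ
    allFats = concatMap (fat ∘ hs) (allFin r)

    owners : ℕ → List (Fin r)
    owners f = filterᵇ (λ i → f ∈ᵇ fat (hs i)) (allFin r)

    ∈-owners : ∀ {f i} → f ∈ fat (hs i) → i ∈ owners f
    ∈-owners f∈ = ∈-filterᵇ⁺ {xs = allFin r} _ (∈-allFin _) (∈⇒∈ᵇ f∈)

  ∈-fat-stripped⁻ : ∀ {f} → f ∈ fat (stripped hs) →
    (∃[ i ] f ∈ fat (hs i)) × (∀ {i j} → f ∈ fat (hs i) → f ∈ fat (hs j) → i ≡ j)
  ∈-fat-stripped⁻ {f} f∈ = owner , at-most-one-owner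
    where
    f∈dedup : f ∈ deduplicateᵇ _≡ᵇ_ allFats
    f∈dedup = proj₁ (∈-filterᵇ⁻ {xs = deduplicateᵇ _≡ᵇ_ allFats} (λ f → fatMult hs f ≤ᵇ 1) f∈)
    |owners|≤1 : length (owners f) ≤ 1
    |owners|≤1 = ≤ᵇ⇒≤ _ 1 (proj₂ (∈-filterᵇ⁻ {xs = deduplicateᵇ _≡ᵇ_ allFats} (λ f → fatMult hs f ≤ᵇ 1) f∈))
    owner : ∃[ i ] f ∈ fat (hs i)
    owner = satisfied (∈-concatMap⁻ (fat ∘ hs) {xs = allFin r} (∈-deduplicate⁻ _ allFats f∈dedup))
    at-most-one-owner : ∀ {i j} → f ∈ fat (hs i) → f ∈ fat (hs j) → i ≡ j
    at-most-one-owner {i} {j} f∈i f∈j with i Fin.≟ j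
    ... | yes i≡j = i≡j
    ... | no  i≢j with ≤-trans (distinct⇒2≤length i≢j (∈-owners f∈i) (∈-owners f∈j)) |owners|≤1
    ...   | s≤s ()

  ∈-fat-stripped⁺ : ∀ {f i} → f ∈ fat (hs i) → (∀ {j} → f ∈ fat (hs j) → j ≡ i) → f ∈ fat (stripped hs)
  ∈-fat-stripped⁺ {f} {i} f∈i only-i = ∈-filterᵇ⁺ (λ f → fatMult hs f ≤ᵇ 1) f∈dedup (≤⇒≤ᵇ |owners|≤1)
    where
    f∈dedup : f ∈ deduplicateᵇ _≡ᵇ_ allFats
    f∈dedup = subst (f ∈_) (sym (deduplicateᵇ≡deduplicate allFats))
                (∈-deduplicate⁺ _≟_ (∈-concatMap⁺ (fat ∘ hs) {xs = allFin r} (lose (∈-allFin i) f∈i)))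
    |owners|≤1 : length (owners f) ≤ 1
    |owners|≤1 = length≤1 (filter⁺ _ (allFin⁺ r)) (λ j∈ k∈ → trans (owner≡i j∈) (sym (owner≡i k∈)))
      where
      owner≡i : ∀ {j} → j ∈ owners f → j ≡ i
      owner≡i j∈ = only-i (∈ᵇ⇒∈ (proj₂ (∈-filterᵇ⁻ {xs = allFin r} (λ j → f ∈ᵇ fat (hs j)) j∈)))

  fat-stripped-unique : Unique (fat (stripped hs))
  fat-stripped-unique = filter⁺ _ (subst Unique (sym (deduplicateᵇ≡deduplicate allFats)) (deduplicate-! allFats))

module ClawSum (cs : List ℕ) (cs-unique : Unique cs) (L : ℕ → List ℕ)
               (centre∉L : ∀ {s s′} → s ∈ cs → s′ ∈ cs → s ∉ L s′) where

  claws : Fin (length cs) → HGraph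
  claws i = clawAt (lookup cs i) (L (lookup cs i))

  data ClawAdj (x y : ℕ) : Set where
    centre-fat    : x ∈ cs → y ∈ L x → ClawAdj x y
    fat-centre    : y ∈ cs → x ∈ L y → ClawAdj x y
    centre-centre : x ∈ cs → y ∈ cs → x ≢ y → ∀ f → f ∈ L x → f ∈ L y → ClawAdj x y

  ClawAdj-sym : ∀ {x y} → ClawAdj x y → ClawAdj y x
  ClawAdj-sym (centre-fat x∈ y∈)                 = fat-centre x∈ y∈
  ClawAdj-sym (fat-centre y∈ x∈)                 = centre-fat y∈ x∈
  ClawAdj-sym (centre-centre x∈ y∈ x≢y f f∈x f∈y) = centre-centre y∈ x∈ (x≢y ∘ sym) f f∈y f∈x

  private
    centre-index : ∀ {s} → s ∈ cs → ∃[ i ] lookup cs i ≡ s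
    centre-index s∈ = Any.index s∈ , sym (lookup-index s∈)

  stripped-claws-adj : ∀ {x y} → Adj (stripped claws) x y ⇔ ClawAdj x y
  stripped-claws-adj = mk⇔ (⇒ ∘ to (stripped-adj claws)) (from (stripped-adj claws) ∘ ⇐)
    where
    ⇒ : ∀ {x y} → SumAdj claws x y → ClawAdj x y
    ⇒ {x} {y} (inside i _ _ a) with to (clawAt-adj {lookup cs i} {L (lookup cs i)} {x} {y}) a
    ... | inj₁ (refl , y∈) = centre-fat (∈-lookup i) y∈
    ... | inj₂ (refl , x∈) = fat-centre (∈-lookup i) x∈
    ⇒ (across i j f i≢j (here refl) (here refl) f∈i f∈j _ _) =
      centre-centre (∈-lookup i) (∈-lookup j) (i≢j ∘ lookup-injective cs-unique) f f∈i f∈j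
    ⇐ : ∀ {x y} → ClawAdj x y → SumAdj claws x y
    ⇐ (centre-fat x∈ y∈) with centre-index x∈
    ... | i , refl = inside i (here refl) (there y∈) (from clawAt-adj (inj₁ (refl , y∈)))
    ⇐ (fat-centre y∈ x∈) with centre-index y∈
    ... | i , refl = inside i (there x∈) (here refl) (from clawAt-adj (inj₂ (refl , x∈)))
    ⇐ (centre-centre x∈ y∈ x≢y f f∈x f∈y) with centre-index x∈ | centre-index y∈
    ... | i , refl | j , refl = across i j f (x≢y ∘ cong (lookup cs)) (here refl) (here refl) f∈x f∈y
                                  (from clawAt-adj (inj₁ (refl , f∈x))) (from clawAt-adj (inj₁ (refl , f∈y)))

  slim-stripped-claws : slim (stripped claws) ≡ cs
  slim-stripped-claws = begin
    concatMap (λ i → lookup cs i ∷ []) (allFin (length cs))  ≡⟨ concatMap-map [_] (lookup cs) (allFin (length cs)) ⟨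
    concatMap [_] (map (lookup cs) (allFin (length cs)))     ≡⟨ concatMap-pure _ ⟩
    map (lookup cs) (allFin (length cs))                     ≡⟨ map-tabulate id (lookup cs) ⟩
    tabulate (lookup cs)                                     ≡⟨ tabulate-lookup cs ⟩
    cs                                                       ∎
    where open ≡-Reasoning

  ∈-fat-claws⁻ : ∀ {f} → f ∈ fat (stripped claws) → ∃[ s ] (s ∈ cs × f ∈ L s)
  ∈-fat-claws⁻ f∈ = let (i , f∈i) , _ = ∈-fat-stripped⁻ claws f∈ in lookup cs i , ∈-lookup i , f∈i

  fat-claws-owner-unique : ∀ {f s s′} → f ∈ fat (stripped claws) → s ∈ cs → s′ ∈ cs → f ∈ L s → f ∈ L s′ → s ≡ s′
  fat-claws-owner-unique f∈ s∈ s′∈ f∈s f∈s′ with centre-index s∈ | centre-index s′∈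
  ... | i , refl | j , refl = cong (lookup cs) (proj₂ (∈-fat-stripped⁻ claws f∈) f∈s f∈s′)

  ∈-fat-claws⁺ : ∀ {f s} → s ∈ cs → f ∈ L s → (∀ {s′} → s′ ∈ cs → f ∈ L s′ → s′ ≡ s) → f ∈ fat (stripped claws)
  ∈-fat-claws⁺ s∈ f∈ only-s with centre-index s∈
  ... | i , refl = ∈-fat-stripped⁺ claws f∈ (λ {j} f∈j → lookup-injective cs-unique (only-s (∈-lookup j) f∈j))

  fat-claws∉cs : ∀ {f} → f ∈ fat (stripped claws) → f ∉ cs
  fat-claws∉cs f∈ f∈cs = let _ , s∈ , f∈s = ∈-fat-claws⁻ f∈ in centre∉L f∈cs s∈ f∈s

  stripped-claws-isHoffman : IsHoffman (stripped claws)
  stripped-claws-isHoffman = record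
    { uniqueV   = subst (λ l → Unique (l ++ fat (stripped claws))) (sym slim-stripped-claws)
                    (++⁺ cs-unique (fat-stripped-unique claws) (λ (f∈cs , f∈) → fat-claws∉cs f∈ f∈cs))
    ; irrefl    = λ _ _ → no-loop ∘ to stripped-claws-adj
    ; sym       = λ _ _ _ _ → from stripped-claws-adj ∘ ClawAdj-sym ∘ to stripped-claws-adj
    ; fatIndep  = λ _ _ f∈ g∈ → fats-apart f∈ g∈ ∘ to stripped-claws-adj
    ; fatHasNbr = λ f f∈ → let s , s∈ , f∈s = ∈-fat-claws⁻ f∈ in
                  s , subst (s ∈_) (sym slim-stripped-claws) s∈ , from stripped-claws-adj (fat-centre s∈ f∈s)
    }
    where
    no-loop : ∀ {x} → ClawAdj x x → ⊥
    no-loop (centre-fat x∈ x∈x)             = centre∉L x∈ x∈ x∈x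
    no-loop (fat-centre x∈ x∈x)             = centre∉L x∈ x∈ x∈x
    no-loop (centre-centre _ _ x≢x _ _ _)   = x≢x refl
    fats-apart : ∀ {f g} → f ∈ fat (stripped claws) → g ∈ fat (stripped claws) → ClawAdj f g → ⊥
    fats-apart f∈ _ (centre-fat f∈cs _)            = fat-claws∉cs f∈ f∈cs
    fats-apart _ g∈ (fat-centre g∈cs _)            = fat-claws∉cs g∈ g∈cs
    fats-apart f∈ _ (centre-centre f∈cs _ _ _ _ _) = fat-claws∉cs f∈ f∈cs

  fat-claws-neighbour : ∀ {f a} → f ∈ fat (stripped claws) → ClawAdj f a → a ∈ cs × f ∈ L a
  fat-claws-neighbour f∈ (centre-fat f∈cs _)            = ⊥-elim (fat-claws∉cs f∈ f∈cs)
  fat-claws-neighbour _  (fat-centre a∈ f∈a)            = a∈ , f∈a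
  fat-claws-neighbour f∈ (centre-centre f∈cs _ _ _ _ _) = ⊥-elim (fat-claws∉cs f∈ f∈cs)

  fat-claws-off-cycles : ∀ {c f} → IsCycle (stripped claws) c → f ∈ c → f ∈ fat (stripped claws) → ⊥
  fat-claws-off-cycles cyc f∈c f∈ =
    let a , b , a≢b , fa , bf = cycle-neighbours cyc f∈c
        a∈ , f∈a = fat-claws-neighbour f∈ (to stripped-claws-adj fa)
        b∈ , f∈b = fat-claws-neighbour f∈ (ClawAdj-sym (to stripped-claws-adj bf))
    in a≢b (fat-claws-owner-unique f∈ a∈ b∈ f∈a f∈b)

  claws-directSumOK : (∀ {s s′ f g} → s ∈ cs → s′ ∈ cs → s ≢ s′ → f ∈ L s → f ∈ L s′ → g ∈ L s → g ∈ L s′ → f ≡ g) →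
                      DirectSumOK claws
  claws-directSumOK one-shared = record
    { slimDisjoint       = λ { i j _ i≢j (here refl) (here eq) → i≢j (lookup-injective cs-unique eq) }
    ; labelsConsistent   = λ { i j _ (here refl) x∈ → centre∉L (∈-lookup i) (∈-lookup j) x∈ }
    ; atMostOneCommonFat = λ { i j _ _ _ _ i≢j (here refl) (here refl) f∈i f∈j _ _ g∈i g∈j _ _ →
        one-shared (∈-lookup i) (∈-lookup j) (i≢j ∘ lookup-injective cs-unique) f∈i f∈j g∈i g∈j }
    }

-- The construction

module Construction (t : HGraph) (t-hoffman : IsHoffman t) (t-tree : TreeLike t)
  (deg≤3 : ∀ v → v ∈ verts t → ¬ IsLeaf t v → degree t v ≤ 3)
  (fat-leaf : ∀ f → f ∈ fat t → IsLeaf t f) where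

  private module H = IsHoffman t-hoffman

  S F V : List ℕ
  S = slim t
  F = fat t
  V = verts t

  S-unique : Unique S
  S-unique = unique-++⁻ˡ H.uniqueV

  S∩F : ∀ {x} → x ∈ S → x ∈ F → ⊥
  S∩F = unique-++-disjoint H.uniqueV

  S⊆V : ∀ {x} → x ∈ S → x ∈ V
  S⊆V = ∈-++⁺ˡ

  F⊆V : ∀ {x} → x ∈ F → x ∈ V
  F⊆V = ∈-++⁺ʳ S

  V∖S⊆F : ∀ {x} → x ∈ V → x ∉ S → x ∈ F
  V∖S⊆F x∈ x∉S with ∈-++⁻ S x∈
  ... | inj₁ x∈S = ⊥-elim (x∉S x∈S)
  ... | inj₂ x∈F = x∈F

  slim-degree≤3 : ∀ {s} → s ∈ S → degree t s ≤ 3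
  slim-degree≤3 {s} s∈ with degree t s ≟ 1
  ... | yes deg≡1 = ≤-trans (≤-reflexive deg≡1) (s≤s z≤n)
  ... | no  deg≢1 = deg≤3 s (S⊆V s∈) deg≢1

  neighbours : ℕ → List ℕ
  neighbours s = filterᵇ (adj t s) V

  fat-neighbours-equal : ∀ {f a b} → f ∈ F → a ∈ V → b ∈ V → Adj t a f → Adj t b f → a ≡ b
  fat-neighbours-equal {f} {a} {b} f∈ a∈ b∈ af bf with a ≟ b
  ... | yes a≡b = a≡b
  ... | no  a≢b = ⊥-elim (<⇒≱ (≤-reflexive (cong suc (fat-leaf f f∈))) (distinct⇒2≤length a≢b (nbr af a∈) (nbr bf b∈)))
    where
    nbr : ∀ {x} → Adj t x f → x ∈ V → x ∈ neighbours f
    nbr xf x∈ = ∈-filterᵇ⁺ (adj t f) x∈ (H.sym _ f x∈ (F⊆V f∈) xf)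

  -- Names from B upwards are not vertices of t; fresh tag x y has base-B digits x, y, tag.
  B : ℕ
  B = suc (sum V)

  V<B : ∀ {x} → x ∈ V → x < B
  V<B x∈ = s≤s (∈⇒≤sum x∈)

  opaque
    fresh : ℕ → ℕ → ℕ → ℕ
    fresh tag x y = B + (x + (y + tag * B) * B)

    fresh∉V : ∀ {tag x y} → fresh tag x y ∉ V
    fresh∉V f∈ = <⇒≱ (V<B f∈) (m≤m+n B _)

    fresh-injective : ∀ {tag tag′ x x′ y y′} → x < B → x′ < B → y < B → y′ < B →
                      fresh tag x y ≡ fresh tag′ x′ y′ → tag ≡ tag′ × x ≡ x′ × y ≡ y′
    fresh-injective {tag} {tag′} {x} {x′} {y} {y′} x<B x′<B y<B y′<B eq =
      let x≡x′ , rest≡ = digits-injective {q = y + tag * B} {q′ = y′ + tag′ * B} x<B x′<B (+-cancelˡ-≡ B _ _ eq)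
          y≡y′ , tag≡tag′ = digits-injective y<B y′<B rest≡
      in tag≡tag′ , x≡x′ , y≡y′

  edgeName : ℕ → ℕ → ℕ
  edgeName s w = fresh 0 (s ⊓ w) (s ⊔ w)

  padName : ℕ → ℕ → ℕ
  padName s k = fresh (suc k) s 0

  edgeName-comm : ∀ s w → edgeName s w ≡ edgeName w s
  edgeName-comm s w = cong₂ (fresh 0) (⊓-comm s w) (⊔-comm s w)

  private
    ⊓<B : ∀ {s w} → s ∈ V → s ⊓ w < B
    ⊓<B {w = w} s∈ = m<n⇒m⊓o<n w (V<B s∈)

    ⊔<B : ∀ {s w} → s ∈ V → w ∈ V → s ⊔ w < B
    ⊔<B s∈ w∈ = ⊔-lub (V<B s∈) (V<B w∈)

  edgeName-injective : ∀ {s w s′ w′} → s ∈ V → w ∈ V → s′ ∈ V → w′ ∈ V → edgeName s w ≡ edgeName s′ w′ →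
                       (s ≡ s′ × w ≡ w′) ⊎ (s ≡ w′ × w ≡ s′)
  edgeName-injective s∈ w∈ s′∈ w′∈ eq =
    let _ , ⊓≡ , ⊔≡ = fresh-injective (⊓<B s∈) (⊓<B s′∈) (⊔<B s∈ w∈) (⊔<B s′∈ w′∈) eq in ⊓-⊔-injective ⊓≡ ⊔≡

  edgeName≢padName : ∀ {s w s′ k} → s ∈ V → w ∈ V → s′ ∈ V → edgeName s w ≢ padName s′ k
  edgeName≢padName s∈ w∈ s′∈ eq = 0≢1+n (proj₁ (fresh-injective (⊓<B s∈) (V<B s′∈) (⊔<B s∈ w∈) (s≤s z≤n) eq))

  padName-injective : ∀ {s s′ k k′} → s ∈ V → s′ ∈ V → padName s k ≡ padName s′ k′ → s ≡ s′ × k ≡ k′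
  padName-injective s∈ s′∈ eq =
    let k+1≡ , s≡s′ , _ = fresh-injective (V<B s∈) (V<B s′∈) (s≤s z≤n) (s≤s z≤n) eq in s≡s′ , suc-injective k+1≡

  -- The claw at a slim vertex s: its fat neighbours, the shared fat vertex edgeName s w for each slim
  -- neighbour w, and private pads up to three fat vertices.
  rename : ℕ → ℕ → ℕ
  rename s w = if does (w ∈? S) then edgeName s w else w

  pads : ℕ → List ℕ
  pads s = map (padName s) (upTo (3 ∸ degree t s))

  renamedNeighbours : ℕ → List ℕ
  renamedNeighbours s = map (rename s) (neighbours s)

  clawFats : ℕ → List ℕ
  clawFats s = renamedNeighbours s ++ pads s

  data FatOf (s y : ℕ) : Set where
    edge : ∀ {w} → w ∈ S → Adj t s w → y ≡ edgeName s w → FatOf s y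
    leaf : y ∈ F → Adj t s y → FatOf s y
    pad  : ∀ {k} → y ≡ padName s k → FatOf s y

  ∈-clawFats⁻ : ∀ {s y} → y ∈ clawFats s → FatOf s y
  ∈-clawFats⁻ {s} y∈ with ∈-++⁻ (renamedNeighbours s) y∈
  ... | inj₂ y∈pads = pad (proj₂ (proj₂ (∈-map⁻ (padName s) y∈pads)))
  ... | inj₁ y∈renamed with ∈-map⁻ (rename s) y∈renamed
  ...   | w , w∈nbrs , refl with ∈-filterᵇ⁻ (adj t s) w∈nbrs | w ∈? S
  ...     | _   , sw | yes w∈S = edge w∈S sw refl
  ...     | w∈V , sw | no  w∉S = leaf (V∖S⊆F w∈V w∉S) sw

  edge∈clawFats : ∀ {s w} → w ∈ S → Adj t s w → edgeName s w ∈ clawFats s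
  edge∈clawFats {s} {w} w∈ sw = ∈-++⁺ˡ (subst (_∈ renamedNeighbours s) (if-yes (w ∈? S) w∈)
                                        (∈-map⁺ (rename s) (∈-filterᵇ⁺ (adj t s) (S⊆V w∈) sw)))

  fat∈clawFats : ∀ {s f} → f ∈ F → Adj t s f → f ∈ clawFats s
  fat∈clawFats {s} {f} f∈ sf = ∈-++⁺ˡ (subst (_∈ renamedNeighbours s) (if-no (f ∈? S) (λ f∈S → S∩F f∈S f∈))
                                       (∈-map⁺ (rename s) (∈-filterᵇ⁺ (adj t s) (F⊆V f∈) sf)))

  clawFats∩V : ∀ {s y} → y ∈ clawFats s → y ∈ V → y ∈ F × Adj t s y
  clawFats∩V y∈ y∈V with ∈-clawFats⁻ y∈
  ... | edge _ _ refl = ⊥-elim (fresh∉V y∈V)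
  ... | leaf y∈F sy   = y∈F , sy
  ... | pad refl      = ⊥-elim (fresh∉V y∈V)

  clawFats∉S : ∀ {s y} → y ∈ clawFats s → y ∉ S
  clawFats∉S y∈ y∈S = S∩F y∈S (proj₁ (clawFats∩V y∈ (S⊆V y∈S)))

  clawFats-length : ∀ {s} → s ∈ S → length (clawFats s) ≡ 3
  clawFats-length {s} s∈ = begin
    length (renamedNeighbours s ++ pads s)          ≡⟨ length-++ (renamedNeighbours s) ⟩
    length (renamedNeighbours s) + length (pads s)  ≡⟨ cong₂ _+_ (length-map (rename s) (neighbours s)) |pads| ⟩
    degree t s + (3 ∸ degree t s)                   ≡⟨ m+[n∸m]≡n (slim-degree≤3 s∈) ⟩
    3                                               ∎
    where
    open ≡-Reasoning
    |pads| : length (pads s) ≡ 3 ∸ degree t s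
    |pads| = trans (length-map (padName s) (upTo (3 ∸ degree t s))) (length-upTo (3 ∸ degree t s))

  clawFats-unique : ∀ {s} → s ∈ V → Unique (clawFats s)
  clawFats-unique {s} s∈ =
    ++⁺ (unique-map⁺ (rename s) rename-injective (filter⁺ _ H.uniqueV))
        (map⁺ (λ eq → proj₂ (padName-injective s∈ s∈ eq)) (upTo⁺ _))
        (λ (y∈renamed , y∈pads) → renamed∉pads y∈renamed y∈pads)
    where
    nbr⊆V : ∀ {w} → w ∈ neighbours s → w ∈ V
    nbr⊆V = proj₁ ∘ ∈-filterᵇ⁻ (adj t s)
    rename-injective : ∀ {x y} → x ∈ neighbours s → y ∈ neighbours s → rename s x ≡ rename s y → x ≡ y
    rename-injective {x} {y} x∈ y∈ eq with x ∈? S | y ∈? S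
    ... | yes _ | yes _ with edgeName-injective s∈ (nbr⊆V x∈) s∈ (nbr⊆V y∈) eq
    ...   | inj₁ (_ , x≡y)        = x≡y
    ...   | inj₂ (s≡y , x≡s)      = trans x≡s s≡y
    rename-injective x∈ y∈ eq | yes _ | no _  = ⊥-elim (fresh∉V (subst (_∈ V) (sym eq) (nbr⊆V y∈)))
    rename-injective x∈ y∈ eq | no _  | yes _ = ⊥-elim (fresh∉V (subst (_∈ V) eq (nbr⊆V x∈)))
    rename-injective x∈ y∈ eq | no _  | no _  = eq
    renamed∉pads : ∀ {y} → y ∈ renamedNeighbours s → y ∈ pads s → ⊥
    renamed∉pads y∈renamed y∈pads with ∈-map⁻ (rename s) y∈renamed | ∈-map⁻ (padName s) y∈pads
    ... | w , w∈ , refl | _ , _ , eq with w ∈? S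
    ...   | yes w∈S = edgeName≢padName s∈ (nbr⊆V w∈) s∈ eq
    ...   | no  _   = fresh∉V (subst (_∈ V) eq (nbr⊆V w∈))

  shared-fat : ∀ {s s′ y} → s ∈ S → s′ ∈ S → s ≢ s′ → y ∈ clawFats s → y ∈ clawFats s′ →
               y ≡ edgeName s s′ × Adj t s s′
  shared-fat {s} {s′} s∈ s′∈ s≢s′ y∈ y∈′ with ∈-clawFats⁻ y∈ | ∈-clawFats⁻ y∈′
  ... | edge {w} w∈ sw refl | edge {w′} w′∈ _ eq with edgeName-injective (S⊆V s∈) (S⊆V w∈) (S⊆V s′∈) (S⊆V w′∈) eq
  ...   | inj₁ (s≡s′ , _) = ⊥-elim (s≢s′ s≡s′)
  ...   | inj₂ (_ , refl) = refl , sw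
  shared-fat _ _ _ _ _ | edge _ _ refl | leaf y∈F _   = ⊥-elim (fresh∉V (F⊆V y∈F))
  shared-fat s∈ s′∈ _ _ _ | edge w∈ _ refl | pad eq   = ⊥-elim (edgeName≢padName (S⊆V s∈) (S⊆V w∈) (S⊆V s′∈) eq)
  shared-fat _ _ _ _ _ | leaf y∈F _ | edge _ _ refl   = ⊥-elim (fresh∉V (F⊆V y∈F))
  shared-fat s∈ s′∈ s≢s′ _ _ | leaf y∈F sy | leaf _ s′y =
    ⊥-elim (s≢s′ (fat-neighbours-equal y∈F (S⊆V s∈) (S⊆V s′∈) sy s′y))
  shared-fat _ _ _ _ _ | leaf y∈F _ | pad refl        = ⊥-elim (fresh∉V (F⊆V y∈F))
  shared-fat s∈ s′∈ _ _ _ | pad refl | edge w∈ _ eq   = ⊥-elim (edgeName≢padName (S⊆V s′∈) (S⊆V w∈) (S⊆V s∈) (sym eq))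
  shared-fat _ _ _ _ _ | pad refl | leaf y∈F _        = ⊥-elim (fresh∉V (F⊆V y∈F))
  shared-fat s∈ s′∈ s≢s′ _ _ | pad refl | pad eq      = ⊥-elim (s≢s′ (proj₁ (padName-injective (S⊆V s∈) (S⊆V s′∈) eq)))

  open ClawSum S S-unique clawFats (λ s∈ _ s∈′ → clawFats∉S s∈′ s∈) public

  t̃ : HGraph
  t̃ = stripped claws

  adj⇔ClawAdj : ∀ {a b} → a ∈ V → b ∈ V → Adj t a b ⇔ ClawAdj a b
  adj⇔ClawAdj {a} {b} a∈ b∈ = mk⇔ ⇒ ⇐
    where
    ⇒ : Adj t a b → ClawAdj a b
    ⇒ ab with ∈-++⁻ S a∈ | ∈-++⁻ S b∈
    ... | inj₁ a∈S | inj₁ b∈S =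
      centre-centre a∈S b∈S (λ { refl → H.irrefl a a∈ ab }) (edgeName a b) (edge∈clawFats b∈S ab)
        (subst (_∈ clawFats b) (edgeName-comm b a) (edge∈clawFats a∈S (H.sym a b a∈ b∈ ab)))
    ... | inj₁ a∈S | inj₂ b∈F = centre-fat a∈S (fat∈clawFats b∈F ab)
    ... | inj₂ a∈F | inj₁ b∈S = fat-centre b∈S (fat∈clawFats a∈F (H.sym a b a∈ b∈ ab))
    ... | inj₂ a∈F | inj₂ b∈F = ⊥-elim (H.fatIndep a b a∈F b∈F ab)
    ⇐ : ClawAdj a b → Adj t a b
    ⇐ (centre-fat _ b∈a)                   = proj₂ (clawFats∩V b∈a b∈)
    ⇐ (fat-centre _ a∈b)                   = H.sym b a b∈ a∈ (proj₂ (clawFats∩V a∈b a∈))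
    ⇐ (centre-centre a∈S b∈S a≢b _ f∈a f∈b) = proj₂ (shared-fat a∈S b∈S a≢b f∈a f∈b)

  adj-t̃⇔adj-t : ∀ {a b} → a ∈ V → b ∈ V → Adj t̃ a b ⇔ Adj t a b
  adj-t̃⇔adj-t a∈ b∈ =
    mk⇔ (from (adj⇔ClawAdj a∈ b∈) ∘ to stripped-claws-adj) (from stripped-claws-adj ∘ to (adj⇔ClawAdj a∈ b∈))

  S⊆slim-t̃ : ∀ {x} → x ∈ S → x ∈ slim t̃
  S⊆slim-t̃ = subst (_ ∈_) (sym slim-stripped-claws)

  F⊆fat-t̃ : ∀ {f} → f ∈ F → f ∈ fat t̃
  F⊆fat-t̃ f∈ with H.fatHasNbr _ f∈
  ... | s , s∈ , fs = ∈-fat-claws⁺ s∈ (fat∈clawFats f∈ sf)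
                        (λ s′∈ f∈s′ → fat-neighbours-equal f∈ (S⊆V s′∈) (S⊆V s∈) (proj₂ (clawFats∩V f∈s′ (F⊆V f∈))) sf)
    where sf = H.sym _ s (F⊆V f∈) (S⊆V s∈) fs

  V⊆verts-t̃ : ∀ {x} → x ∈ V → x ∈ verts t̃
  V⊆verts-t̃ x∈ with ∈-++⁻ S x∈
  ... | inj₁ x∈S = ∈-++⁺ˡ (S⊆slim-t̃ x∈S)
  ... | inj₂ x∈F = ∈-++⁺ʳ (slim t̃) (F⊆fat-t̃ x∈F)

  t-embedding : Embedding t t̃ id
  t-embedding = record
    { injective = λ _ _ _ _ → id
    ; slim↦slim = λ _ → S⊆slim-t̃
    ; fat↦fat   = λ _ → F⊆fat-t̃
    ; adjPres   = λ _ _ a∈ b∈ → T⇔T⇒≡ (from (adj-t̃⇔adj-t a∈ b∈)) (to (adj-t̃⇔adj-t a∈ b∈))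
    }

  lift-walk : ∀ {a b} → Walk t a b → Walk t̃ a b
  lift-walk (here a∈)     = here (V⊆verts-t̃ a∈)
  lift-walk (step a∈ ab w) = step (V⊆verts-t̃ a∈) (from (adj-t̃⇔adj-t a∈ (walk-source w)) ab) (lift-walk w)

  anchored : ∀ {x} → x ∈ verts t̃ → ∃[ a ] (a ∈ V × Walk t̃ x a × Walk t̃ a x)
  anchored {x} x∈ with ∈-++⁻ (slim t̃) x∈
  ... | inj₁ x∈slim = x , S⊆V (subst (x ∈_) slim-stripped-claws x∈slim) , here x∈ , here x∈
  ... | inj₂ x∈fat =
    let s , s∈ , x∈s = ∈-fat-claws⁻ x∈fat
        s∈t̃ = ∈-++⁺ˡ (S⊆slim-t̃ s∈)
    in s , S⊆V s∈ , step x∈ (from stripped-claws-adj (fat-centre s∈ x∈s)) (here s∈t̃)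
                  , step s∈t̃ (from stripped-claws-adj (centre-fat s∈ x∈s)) (here x∈)

  t̃-connected : Connected t̃
  t̃-connected x y x∈ y∈ =
    let a , a∈ , x→a , _ = anchored x∈
        b , b∈ , _ , b→y = anchored y∈
    in walk-++ x→a (walk-++ (lift-walk (proj₁ (proj₂ t-tree) a b a∈ b∈)) b→y)

  t̃-acyclic : Acyclic t̃
  t̃-acyclic c cyc = proj₂ (proj₂ t-tree) c (IsCycle-transfer (λ a∈ b∈ → to (adj-t̃⇔adj-t a∈ b∈)) c on-V cyc)
    where
    on-V : All (_∈ V) c
    on-V = All.tabulate λ {v} v∈c → case (∈-++⁻ (slim t̃) (All.lookup (cycle-vertices c cyc) v∈c)) of λ
      { (inj₁ v∈slim) → S⊆V (subst (v ∈_) slim-stripped-claws v∈slim)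
      ; (inj₂ v∈fat)  → ⊥-elim (fat-claws-off-cycles cyc v∈c v∈fat) }

  t̃-treeLike : TreeLike t̃
  t̃-treeLike = ∈⇒1≤length (V⊆verts-t̃ (proj₂ (1≤length⇒∃∈ (proj₁ t-tree)))) , t̃-connected , t̃-acyclic

  claws-are-claws : ∀ i → IsHoffman (claws i) × Isomorphic (claws i) claw
  claws-are-claws i = clawAt-isHoffman centre∷fats-unique , clawAt≅claw centre∷fats-unique (clawFats-length s∈)
    where
    s∈ = ∈-lookup i
    centre∷fats-unique : Unique (lookup S i ∷ clawFats (lookup S i))
    centre∷fats-unique = All.tabulate (λ y∈ s≡y → clawFats∉S y∈ (subst (_∈ S) s≡y s∈)) ∷ clawFats-unique (S⊆V s∈)

  directSumOK : DirectSumOK claws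
  directSumOK = claws-directSumOK λ s∈ s′∈ s≢s′ f∈ f∈′ g∈ g∈′ →
    trans (proj₁ (shared-fat s∈ s′∈ s≢s′ f∈ f∈′)) (sym (proj₁ (shared-fat s∈ s′∈ s≢s′ g∈ g∈′)))

  -- The fat vertices of the direct sum adjacent to x (just x when x is fat); x is represented by the
  -- sum of their unit vectors, so inner products count common elements of supports.
  support : ℕ → List ℕ
  support x = if does (x ∈? S) then clawFats x else x ∷ []

  clawFats⊆support : ∀ {x z} → x ∈ S → z ∈ clawFats x → z ∈ support x
  clawFats⊆support {x} x∈S = subst (_ ∈_) (sym (if-yes (x ∈? S) x∈S))

  self∈support : ∀ {x} → x ∉ S → x ∈ support x
  self∈support {x} x∉S = subst (x ∈_) (sym (if-no (x ∈? S) x∉S)) (here refl)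

  support-unique : ∀ {x} → x ∈ V → Unique (support x)
  support-unique {x} x∈ with x ∈? S
  ... | yes _ = clawFats-unique x∈
  ... | no  _ = [] ∷ []

  support-common : ∀ {x y z} → x ∈ V → y ∈ V → x ≢ y → z ∈ support x → z ∈ support y →
                   Adj t x y × (∀ {z′} → z′ ∈ support x → z′ ∈ support y → z′ ≡ z)
  support-common {x} {y} x∈ y∈ x≢y z∈x z∈y with x ∈? S | y ∈? S
  ... | yes x∈S | yes y∈S =
    let z≡ , xy = shared-fat x∈S y∈S x≢y z∈x z∈y
    in xy , λ z′∈x z′∈y → trans (proj₁ (shared-fat x∈S y∈S x≢y z′∈x z′∈y)) (sym z≡)
  ... | yes _ | no _ with z∈y
  ...   | here refl = proj₂ (clawFats∩V z∈x y∈) , λ { _ (here refl) → refl }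
  support-common x∈ y∈ x≢y z∈x z∈y | no _ | yes _ with z∈x
  ...   | here refl = H.sym _ _ y∈ x∈ (proj₂ (clawFats∩V z∈y x∈)) , λ { (here refl) _ → refl }
  support-common x∈ y∈ x≢y z∈x z∈y | no _ | no _ with z∈x | z∈y
  ...   | here refl | here refl = ⊥-elim (x≢y refl)

  adj⇒support-common : ∀ {x y} → x ∈ V → y ∈ V → Adj t x y → ∃[ c ] (c ∈ support x × c ∈ support y)
  adj⇒support-common {x} {y} x∈ y∈ xy with to (adj⇔ClawAdj x∈ y∈) xy
  ... | centre-fat x∈S y∈x              = y , clawFats⊆support x∈S y∈x , self∈support (clawFats∉S y∈x)
  ... | fat-centre y∈S x∈y              = x , self∈support (clawFats∉S x∈y) , clawFats⊆support y∈S x∈y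
  ... | centre-centre x∈S y∈S _ f f∈x f∈y = f , clawFats⊆support x∈S f∈x , clawFats⊆support y∈S f∈y

  M : ℕ
  M = suc (sum (concatMap support V))

  support<M : ∀ {x} → x ∈ V → All (_< M) (support x)
  support<M x∈ = All.tabulate (λ z∈ → s≤s (∈⇒≤sum (∈-concatMap⁺ support (lose x∈ z∈))))

  vector : ℕ → Vec ℤ M
  vector = indicator M ∘ support

  representation : IntRepNorm3 t
  representation = M , vector , slim-norm , fat-norm , pairs
    where
    norm : ∀ {x} → x ∈ V → dot (vector x) (vector x) ≡ + length (support x)
    norm x∈ = dot-indicator M (support-unique x∈) (support<M x∈) (mk⇔ proj₁ (λ z∈ → z∈ , z∈))
    slim-norm : ∀ x → x ∈ S → dot (vector x) (vector x) ≡ + 3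
    slim-norm x x∈ = trans (norm (S⊆V x∈)) (cong +_ (trans (cong length (if-yes (x ∈? S) x∈)) (clawFats-length x∈)))
    fat-norm : ∀ x → x ∈ F → dot (vector x) (vector x) ≡ + 1
    fat-norm x x∈ = trans (norm (F⊆V x∈)) (cong (+_ ∘ length) (if-no (x ∈? S) (λ x∈S → S∩F x∈S x∈)))
    pairs : ∀ x y → x ∈ V → y ∈ V → x ≢ y →
            (Adj t x y → dot (vector x) (vector y) ≡ + 1) × (¬ Adj t x y → dot (vector x) (vector y) ≡ + 0)
    pairs x y x∈ y∈ x≢y = adjacent , non-adjacent
      where
      adjacent : Adj t x y → dot (vector x) (vector y) ≡ + 1
      adjacent xy =
        let c , c∈x , c∈y = adj⇒support-common x∈ y∈ xy
        in dot-indicator M ([] ∷ []) (All.lookup (support<M x∈) c∈x ∷ [])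
             (mk⇔ (λ (z∈x , z∈y) → here (proj₂ (support-common x∈ y∈ x≢y c∈x c∈y) z∈x z∈y))
                  (λ { (here refl) → c∈x , c∈y }))
      non-adjacent : ¬ Adj t x y → dot (vector x) (vector y) ≡ + 0
      non-adjacent ¬xy = dot-indicator M [] []
        (mk⇔ (λ (z∈x , z∈y) → ⊥-elim (¬xy (proj₁ (support-common x∈ y∈ x≢y z∈x z∈y)))) λ ())

proposition3p9 : (t : HGraph) → IsHoffman t → TreeLike t
    → (∀ v → v ∈ verts t → ¬ IsLeaf t v → degree t v ≤ 3)
    → (∀ f → f ∈ fat t → IsLeaf t f)
    → Σ (Fin (length (slim t)) → HGraph) (λ ts →
          (∀ i → IsHoffman (ts i) × Isomorphic (ts i) claw)
        × DirectSumOK ts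
        × IsHoffman (stripped ts)
        × TreeLike (stripped ts)
        × length (slim (stripped ts)) ≡ length (slim t)
        × InducedSub t (stripped ts))
      × IntRepNorm3 t
proposition3p9 t t-hoffman t-tree deg≤3 fat-leaf =
  ( claws , claws-are-claws , directSumOK , stripped-claws-isHoffman , t̃-treeLike
  , cong length slim-stripped-claws , id , t-embedding ) ,
  representation
  where open Construction t t-hoffman t-tree deg≤3 fat-leaf
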